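{- Let $k\ge 1$. For every $\boldsymbol{F}\in\mathcal{TW}(k)$ one of the following holds: (1) $\boldsymbol{F}=\boldsymbol{1}$; (2) $\boldsymbol{F}=\prod_{ij\in A}\boldsymbol{A}^{ij}\cdot\boldsymbol{F}'$ for some $A\subseteq\binom{[k]}{2}$ and some $\boldsymbol{F}'\in\mathcal{TW}(k)$ with fewer edges than $\boldsymbol{F}$; (3) $\boldsymbol{F}=\boldsymbol{J}^i\cdot\boldsymbol{F}'$ for some $i\in[k]$ and some $\boldsymbol{F}'\in\mathcal{TW}(k)$ with fewer vertices than $\boldsymbol{F}$; (4) $\boldsymbol{F}=\boldsymbol{F}_1\odot\boldsymbol{F}_2$ for some $\boldsymbol{F}_1,\boldsymbol{F}_2\in\mathcal{TW}(k)$ each with fewer vertices than $\boldsymbol{F}$.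
   Context: A distinctly $k$-labelled graph is $(F,\boldsymbol{u})$ with $\boldsymbol{u}\in V(F)^k$ of pairwise distinct entries; a distinctly $(k,k)$-bilabelled graph is $(F,\boldsymbol{u},\boldsymbol{v})$ with $\boldsymbol{u},\boldsymbol{v}\in V(F)^k$ each having pairwise distinct entries (they may share entries). Equalities are up to isomorphism of labelled graphs. $\mathcal{TW}(k)=\bigcup_{d\ge1}\mathcal{TW}_d(k)$ is the set of distinctly $k$-labelled graphs $(F,\boldsymbol{u})$ such that $F$ has a tree decomposition $(T,\beta)$ with $|\beta(t)|=k$ for all nodes $t$, $|\beta(s)\cap\beta(t)|=k-1$ for all $st\in E(T)$, and a node $r$ with $\beta(r)=\{u_1,\dots,u_k\}$ such that every node of the rooted tree $(T,r)$ has at most $k$ children. Operations: gluing $(F,\boldsymbol{u})\odot(F',\boldsymbol{u}')$ is the disjoint union with $u_i$ merged with $u'_i$ (carrying label $i$) for all $i$; series composition of a bilabelled $(K,\boldsymbol{x},\boldsymbol{y})$ with a labelled $(F,\boldsymbol{u})$ is the disjoint union of $K$ and $F$ with $y_i$ identified with $u_i$ for all $i$, labelled by $\boldsymbol{x}$; series composition of two bilabelled graphs is defined analogously (identify out-labels of the first with in-labels of the second; in-labels of the first, out-labels of the second). Generators: $\boldsymbol{1}$ is the $k$-labelled graph on vertices $[k]$ with no edges, labelled $(1,\dots,k)$; for $i\in[k]$, $\boldsymbol{J}^i=(J^i,(1,\dots,k),(1,\dots,i-1,\hat{i},i+1,\dots,k))$ with $V(J^i)=[k]\cup\{\hat i\}$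 and no edges; for $ij\in\binom{[k]}{2}$, $\boldsymbol{A}^{ij}=(A^{ij},(1,\dots,k),(1,\dots,k))$ with $V(A^{ij})=[k]$ and $E(A^{ij})=\{ij\}$. -}

module Defs where

open import Data.Nat using (ℕ; zero; suc; _≤_; _<_; _∸_)
open import Data.Bool using (Bool; true; false; _∧_; if_then_else_)
open import Data.Fin using (Fin) renaming (_<_ to _<ᶠ_)
import Data.Fin as Fin
import Data.Fin.Properties as FinP
open import Data.Fin.Subset using (Subset; _∈_; _∉_; ∣_∣; _∩_)
open import Data.Maybe using (Maybe; just; nothing)
import Data.Maybe.Properties as MaybeP
open import Data.Sum using (_⊎_; inj₁; inj₂)
open import Data.Product using (Σ; ∃; ∃₂; _×_; _,_; proj₁; proj₂)
open import Data.Empty using (⊥)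
open import Data.List using (List; []; _∷_; map; foldr; allFin)
open import Data.Nat.ListAction using (sum)
open import Data.List.Relation.Unary.All using (All)
open import Data.List.Relation.Unary.Unique.Propositional using (Unique)
import Data.List.Membership.Propositional as LMem
open import Relation.Binary.PropositionalEquality using (_≡_; _≢_; refl; cong)
open import Relation.Binary.Definitions using (DecidableEquality)
open import Relation.Nullary using (¬_; Dec; yes; no)
open import Relation.Nullary.Decidable using (⌊_⌋)
open import Function using (_∘_; id)
open import Function.Bundles using (_↔_; _⇔_; Inverse)
open import Function.Definitions using (Injective)

record Graph : Set where
  field
    n     : ℕ
    adj   : Fin n → Fin n → Bool
    adj-sym : ∀ x y → adj x y ≡ adj y x
    adj-irr : ∀ x → adj x x ≡ false
open Graph public

edges : Graph → ℕ
edges G = sum (map (λ x → sum (map (λ y → if ⌊ x Fin.<? y ⌋ ∧ adj G x y then 1 else 0)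
                                        (allFin (n G))))
                   (allFin (n G)))

record DLab (k : ℕ) : Set where
  field
    graph : Graph
    lab   : Fin k → Fin (n graph)
    lab-inj : Injective _≡_ _≡_ lab
open DLab public

nV : ∀ {k} → DLab k → ℕ
nV F = n (graph F)

nE : ∀ {k} → DLab k → ℕ
nE F = edges (graph F)

data Walk (G : Graph) : Fin (n G) → Fin (n G) → Set where
  stop : ∀ {x} → Walk G x x
  step : ∀ {x y z} → adj G x y ≡ true → Walk G y z → Walk G x z

verts : ∀ {G x y} → Walk G x y → List (Fin (n G))
verts {x = x} stop = x ∷ []
verts {x = x} (step _ w) = x ∷ verts w

len : ∀ {G x y} → Walk G x y → ℕ
len stop = 0
len (step _ w) = suc (len w)

Connected : Graph → Set
Connected G = ∀ s t → Walk G s t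

Acyclic : Graph → Set
Acyclic G = ¬ (Σ (Fin (n G)) λ x → Σ (Fin (n G)) λ y → Σ (Walk G y x) λ w →
               adj G x y ≡ true × Unique (verts w) × 2 ≤ len w)

-- in the tree T rooted at r, s is a child of t iff st is an edge and
-- s does not lie on the (unique) r–t path
Child : (T : Graph) → Fin (n T) → Fin (n T) → Fin (n T) → Set
Child T r t s = adj T t s ≡ true ×
  Σ (Walk T r t) λ p → Unique (verts p) × ¬ (LMem._∈_ s (verts p))

-- (T , r): every node has at most k children (no k+1 distinct children)
AtMostChildren : ℕ → (T : Graph) → Fin (n T) → Set
AtMostChildren k T r = ∀ t → ¬ (Σ (Fin (suc k) → Fin (n T)) λ f →
                                 Injective _≡_ _≡_ f × (∀ j → Child T r t (f j)))

record TWDecomp (k : ℕ) (F : DLab k) : Set where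
  field
    T      : Graph
    T-conn : Connected T
    T-acyc : Acyclic T
    β      : Fin (n T) → Subset (nV F)
    cover-v : ∀ v → ∃ λ t → v ∈ β t
    cover-e : ∀ v w → adj (graph F) v w ≡ true → ∃ λ t → v ∈ β t × w ∈ β t
    coherent : ∀ v t t' → v ∈ β t → v ∈ β t' →
               Σ (Walk T t t') λ p → All (λ s → v ∈ β s) (verts p)
    bag-size : ∀ t → ∣ β t ∣ ≡ k
    adj-size : ∀ s t → adj T s t ≡ true → ∣ β s ∩ β t ∣ ≡ k ∸ 1
    root     : Fin (n T)
    root-bag : ∀ v → (v ∈ β root) ⇔ (∃ λ i → lab F i ≡ v)
    children : AtMostChildren k T root

TW : (k : ℕ) → DLab k → Set
TW k F = TWDecomp k F

-- General graphs (arbitrary vertex type with decidable equality),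
-- used as the results of the gluing / series-composition constructions

record Gr : Set₁ where
  field
    V   : Set
    dec : DecidableEquality V
    E   : V → V → Set

record LGr (k : ℕ) : Set₁ where
  field
    G   : Gr
    lab : Fin k → Gr.V G

record BGr (k : ℕ) : Set₁ where
  field
    G   : Gr
    inl  : Fin k → Gr.V G
    outl : Fin k → Gr.V G

toGr : Graph → Gr
toGr H = record { V = Fin (n H) ; dec = FinP._≟_ ; E = λ x y → adj H x y ≡ true }

toL : ∀ {k} → DLab k → LGr k
toL F = record { G = toGr (graph F) ; lab = lab F }

-- Disjoint union of G₁ and G₂ with b i (in G₂) identified with a i (in G₁)
module Push (G₁ G₂ : Gr) {k : ℕ} (a : Fin k → Gr.V G₁) (b : Fin k → Gr.V G₂) where
  open Gr

  record Unl : Set where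
    constructor unl
    field
      v : V G₂
      .free : ∀ i → v ≢ b i
  open Unl

  Carrier : Set
  Carrier = V G₁ ⊎ Unl

  ι₁ : V G₁ → Carrier
  ι₁ = inj₁

  ι₂ : V G₂ → Carrier
  ι₂ v with FinP.any? (λ i → dec G₂ v (b i))
  ... | yes (i , _) = inj₁ (a i)
  ... | no ¬p = inj₂ (unl v (λ i eq → ¬p (i , eq)))

  decC : DecidableEquality Carrier
  decC (inj₁ x) (inj₁ y) with dec G₁ x y
  ... | yes refl = yes refl
  ... | no ne = no λ { refl → ne refl }
  decC (inj₁ x) (inj₂ y) = no λ ()
  decC (inj₂ x) (inj₁ y) = no λ ()
  decC (inj₂ (unl x _)) (inj₂ (unl y _)) with dec G₂ x y
  ... | yes refl = yes refl
  ... | no ne = no λ { refl → ne refl }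

  EC : Carrier → Carrier → Set
  EC p q = (∃₂ λ x y → ι₁ x ≡ p × ι₁ y ≡ q × E G₁ x y)
         ⊎ (∃₂ λ x y → ι₂ x ≡ p × ι₂ y ≡ q × E G₂ x y)

  pushout : Gr
  pushout = record { V = Carrier ; dec = decC ; E = EC }

_⊙_ : ∀ {k} → LGr k → LGr k → LGr k
F₁ ⊙ F₂ = record { G = Push.pushout (LGr.G F₁) (LGr.G F₂) (LGr.lab F₁) (LGr.lab F₂)
                 ; lab = inj₁ ∘ LGr.lab F₁ }

_·_ : ∀ {k} → BGr k → LGr k → LGr k
K · F = record { G = Push.pushout (BGr.G K) (LGr.G F) (BGr.outl K) (LGr.lab F)
               ; lab = inj₁ ∘ BGr.inl K }

_∙_ : ∀ {k} → BGr k → BGr k → BGr k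
K ∙ L = record { G = Push.pushout (BGr.G K) (BGr.G L) (BGr.outl K) (BGr.inl L)
               ; inl = inj₁ ∘ BGr.inl K
               ; outl = Push.ι₂ (BGr.G K) (BGr.G L) (BGr.outl K) (BGr.inl L) ∘ BGr.outl L }

𝟏 : (k : ℕ) → LGr k
𝟏 k = record { G = record { V = Fin k ; dec = FinP._≟_ ; E = λ _ _ → ⊥ } ; lab = id }

𝐈 : (k : ℕ) → BGr k
𝐈 k = record { G = record { V = Fin k ; dec = FinP._≟_ ; E = λ _ _ → ⊥ } ; inl = id ; outl = id }

-- J^i : vertices [k] ∪ {î} (î = nothing), no edges
𝐉 : (k : ℕ) → Fin k → BGr k
𝐉 k i = record
  { G = record { V = Maybe (Fin k) ; dec = MaybeP.≡-dec FinP._≟_ ; E = λ _ _ → ⊥ }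
  ; inl = just
  ; outl = λ l → if ⌊ FinP._≟_ l i ⌋ then nothing else just l }

𝐀 : (k : ℕ) → Fin k → Fin k → BGr k
𝐀 k i j = record
  { G = record { V = Fin k ; dec = FinP._≟_
               ; E = λ x y → (x ≡ i × y ≡ j) ⊎ (x ≡ j × y ≡ i) }
  ; inl = id ; outl = id }

-- ∏_{ij ∈ A} A^{ij}, for A ⊆ ([k] choose 2) given as a duplicate-free
-- list of pairs (i , j) with i < j
prodA : (k : ℕ) → List (Fin k × Fin k) → BGr k
prodA k = foldr (λ p acc → 𝐀 k (proj₁ p) (proj₂ p) ∙ acc) (𝐈 k)

IsPairSet : ∀ {k} → List (Fin k × Fin k) → Set
IsPairSet A = All (λ p → proj₁ p <ᶠ proj₂ p) A × Unique A

_≅_ : ∀ {k} → DLab k → LGr k → Set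
F ≅ H = Σ (Fin (nV F) ↔ Gr.V (LGr.G H)) λ φ →
          (∀ x y → (adj (graph F) x y ≡ true) ⇔ Gr.E (LGr.G H) (Inverse.to φ x) (Inverse.to φ y))
        × (∀ i → Inverse.to φ (lab F i) ≡ LGr.lab H i)

-- Fix a decomposition (T, β) of F rooted at r. If two labelled vertices are adjacent, deleting that
-- edge leaves (T, β) a decomposition, and F = A^{ij} · F′. Otherwise look at the neighbours of r in T.
-- With none, T is a single node and F = 1. With exactly one neighbour c, the vertex u of β(r) ∖ β(c)
-- lies in no other bag, so it is isolated (its neighbours would be labels); dropping r and rooting at c,
-- where the vertex of β(c) ∖ β(r) takes over the label of u, gives F = J^i · F′. With two neighbours
-- c₁ ≠ c₂, split T − r into the component of c₁ and the rest: each part together with r decomposes the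
-- subgraph spanned by its bags, the two subgraphs meet exactly in the root bag, so F is their gluing,
-- and each misses the vertex of β(cⱼ) ∖ β(r) on the other side.

module Submission where

open import Defs
open import Data.Nat using (ℕ; zero; suc; _≤_; _<_; _∸_; z≤n; s≤s)
import Data.Nat.Properties as ℕP
open import Data.Nat.ListAction using (sum)
open import Data.Bool using (Bool; true; false; _∧_; _∨_; not; if_then_else_)
import Data.Bool.Properties as BoolP
open import Data.Fin using (Fin; zero; suc) renaming (_<_ to _<ᶠ_)
import Data.Fin as Fin
import Data.Fin.Properties as FinP
open import Data.Fin.Subset
  using (Subset; ∣_∣; _∩_; _⊆_; _-_; ⁅_⁆) renaming (_∈_ to _∈ₛ_; _∉_ to _∉ₛ_)
open import Data.Fin.Subset.Properties
  using (_∈?_; _⊆?_; drop-∷-⊆; x∈p∩q⁻; x∈p∩q⁺; x∈p∧x≢y⇒x∈p-y; x∈p⇒∣p-x∣<∣p∣; p⊆q⇒∣p∣≤∣q∣;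
         p⊂q⇒∣p∣<∣q∣; ∈⊤; ∣⊤∣≡n; ∣p∣≤n; x∈⁅x⁆; x∈⁅y⁆⇒x≡y; ∣⁅x⁆∣≡1)
open import Data.Vec using ([]; _∷_; here; there; tabulate)
open import Data.Vec.Properties using ([]=⇒lookup; lookup⇒[]=; lookup∘tabulate)
open import Data.Maybe using (Maybe; just; nothing)
open import Data.List using (List; []; _∷_; map; allFin)
open import Data.List.Relation.Unary.All using (All; []; _∷_)
import Data.List.Relation.Unary.All as All
import Data.List.Relation.Unary.All.Properties as AllP
open import Data.List.Relation.Unary.Any using (here; there)
open import Data.List.Relation.Unary.AllPairs using ([]; _∷_)
open import Data.List.Relation.Unary.Unique.Propositional using (Unique)
import Data.List.Relation.Unary.Unique.Propositional.Properties as UniqueP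
open import Data.List.Membership.Propositional using () renaming (_∈_ to _∈ₗ_)
open import Data.List.Membership.Propositional.Properties using (∈-map⁻; ∈-allFin)
open import Data.List.Relation.Binary.Subset.Propositional using () renaming (_⊆_ to _⊆ₗ_)
open import Data.Product using (Σ; ∃; ∃₂; _×_; _,_; proj₁; proj₂)
open import Data.Sum using (_⊎_; inj₁; inj₂)
open import Data.Empty using (⊥; ⊥-elim)
import Data.Empty.Irrelevant as Irrelevant
open import Relation.Binary.PropositionalEquality
open import Relation.Binary.Definitions using (tri<; tri≈; tri>)
open import Relation.Nullary using (¬_; Dec; yes; no; does; ¬?; _×-dec_; _⊎-dec_; decidable-stable)
open import Relation.Nullary.Decidable using (⌊_⌋)
open import Relation.Unary using (Pred; Decidable)
open import Level using (0ℓ)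
open import Function using (_∘_; id)
open import Function.Definitions using (Injective)
open import Function.Bundles using (_⇔_; mk⇔; mk↔ₛ′; Equivalence)

private
  false≢true : false ≢ true
  false≢true ()

private
  variable
    m : ℕ

embed : (p : Subset m) → Fin ∣ p ∣ → Fin m
embed (true  ∷ p) zero    = zero
embed (true  ∷ p) (suc j) = suc (embed p j)
embed (false ∷ p) j       = suc (embed p j)

embed-∈ : ∀ (p : Subset m) j → embed p j ∈ₛ p
embed-∈ (true  ∷ p) zero    = here
embed-∈ (true  ∷ p) (suc j) = there (embed-∈ p j)
embed-∈ (false ∷ p) j       = there (embed-∈ p j)

embed-injective : ∀ (p : Subset m) → Injective _≡_ _≡_ (embed p)
embed-injective (true  ∷ p) {zero}  {zero}  _  = refl
embed-injective (true  ∷ p) {suc i} {suc j} eq = cong suc (embed-injective p (FinP.suc-injective eq))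
embed-injective (false ∷ p)                 eq = embed-injective p (FinP.suc-injective eq)

embed-surjective : ∀ (p : Subset m) {x} → x ∈ₛ p → ∃ λ j → embed p j ≡ x
embed-surjective (true ∷ p) here = zero , refl
embed-surjective (true ∷ p) (there x∈p) with embed-surjective p x∈p
... | j , refl = suc j , refl
embed-surjective (false ∷ p) (there x∈p) with embed-surjective p x∈p
... | j , refl = j , refl

-- q as a subset of p, in the coordinates given by embed p
restrict : Subset m → (p : Subset m) → Subset ∣ p ∣
restrict []      []          = []
restrict (b ∷ q) (true  ∷ p) = b ∷ restrict q p
restrict (b ∷ q) (false ∷ p) = restrict q p

∈-restrict⁺ : ∀ (q p : Subset m) j → embed p j ∈ₛ q → j ∈ₛ restrict q p
∈-restrict⁺ (b ∷ q) (true  ∷ p) zero    here        = here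
∈-restrict⁺ (b ∷ q) (true  ∷ p) (suc j) (there x∈q) = there (∈-restrict⁺ q p j x∈q)
∈-restrict⁺ (b ∷ q) (false ∷ p) j       (there x∈q) = ∈-restrict⁺ q p j x∈q

∈-restrict⁻ : ∀ (q p : Subset m) j → j ∈ₛ restrict q p → embed p j ∈ₛ q
∈-restrict⁻ (b ∷ q) (true  ∷ p) zero    here        = here
∈-restrict⁻ (b ∷ q) (true  ∷ p) (suc j) (there j∈q) = there (∈-restrict⁻ q p j j∈q)
∈-restrict⁻ (b ∷ q) (false ∷ p) j       j∈q         = there (∈-restrict⁻ q p j j∈q)

restrict-∩ : ∀ (q q′ p : Subset m) → restrict (q ∩ q′) p ≡ restrict q p ∩ restrict q′ p
restrict-∩ []      []       []          = refl
restrict-∩ (b ∷ q) (c ∷ q′) (true  ∷ p) = cong (b ∧ c ∷_) (restrict-∩ q q′ p)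
restrict-∩ (b ∷ q) (c ∷ q′) (false ∷ p) = restrict-∩ q q′ p

∣restrict∣≡ : ∀ (q p : Subset m) → q ⊆ p → ∣ restrict q p ∣ ≡ ∣ q ∣
∣restrict∣≡ []          []          _   = refl
∣restrict∣≡ (true  ∷ q) (true  ∷ p) q⊆p = cong suc (∣restrict∣≡ q p (drop-∷-⊆ q⊆p))
∣restrict∣≡ (false ∷ q) (true  ∷ p) q⊆p = ∣restrict∣≡ q p (drop-∷-⊆ q⊆p)
∣restrict∣≡ (false ∷ q) (false ∷ p) q⊆p = ∣restrict∣≡ q p (drop-∷-⊆ q⊆p)
∣restrict∣≡ (true  ∷ q) (false ∷ p) q⊆p with q⊆p here
... | ()

subsetOf : ∀ {ℓ} {P : Pred (Fin m) ℓ} → Decidable P → Subset m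
subsetOf P? = tabulate (does ∘ P?)

∈-subsetOf⁻ : ∀ {ℓ} {P : Pred (Fin m) ℓ} (P? : Decidable P) {x} → x ∈ₛ subsetOf P? → P x
∈-subsetOf⁻ P? {x} x∈ with P? x | trans (sym (lookup∘tabulate (does ∘ P?) x)) ([]=⇒lookup x∈)
... | yes px | _ = px
... | no  _  | ()

∈-subsetOf⁺ : ∀ {ℓ} {P : Pred (Fin m) ℓ} (P? : Decidable P) {x} → P x → x ∈ₛ subsetOf P?
∈-subsetOf⁺ P? {x} px = lookup⇒[]= x _ (trans (lookup∘tabulate (does ∘ P?) x) (does-yes (P? x)))
  where
  does-yes : (d : Dec _) → does d ≡ true
  does-yes (yes _) = refl
  does-yes (no ¬px) = ⊥-elim (¬px px)

x∉p⇒∣p∣<m : ∀ (p : Subset m) x → x ∉ₛ p → ∣ p ∣ < m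
x∉p⇒∣p∣<m p x x∉p = subst (∣ p ∣ <_) (∣⊤∣≡n _) (p⊂q⇒∣p∣<∣q∣ ((λ _ → ∈⊤) , x , ∈⊤ , x∉p))

⊈⇒∃∈∉ : ∀ (p q : Subset m) → ¬ p ⊆ q → ∃ λ x → x ∈ₛ p × x ∉ₛ q
⊈⇒∃∈∉ p q p⊈q with FinP.any? (λ x → (x ∈? p) ×-dec ¬? (x ∈? q))
... | yes witness = witness
... | no none = ⊥-elim (p⊈q λ {x} x∈p → inside x x∈p (x ∈? q))
  where
  inside : ∀ x → x ∈ₛ p → Dec (x ∈ₛ q) → x ∈ₛ q
  inside x _   (yes x∈q) = x∈q
  inside x x∈p (no x∉q)  = ⊥-elim (none (x , x∈p , x∉q))

∣p∩q∣<∣p∣⇒∃∈∉ : ∀ (p q : Subset m) → ∣ p ∩ q ∣ < ∣ p ∣ → ∃ λ x → x ∈ₛ p × x ∉ₛ q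
∣p∩q∣<∣p∣⇒∃∈∉ p q lt = ⊈⇒∃∈∉ p q λ p⊆q →
  ℕP.<⇒≱ lt (p⊆q⇒∣p∣≤∣q∣ λ x∈p → x∈p∩q⁺ (x∈p , p⊆q x∈p))

∉-unique : ∀ (p q : Subset m) → ∣ p ∣ ≤ suc ∣ p ∩ q ∣ →
           ∀ {x y} → x ∈ₛ p → x ∉ₛ q → y ∈ₛ p → y ∉ₛ q → y ≡ x
∉-unique p q size {x} {y} x∈p x∉q y∈p y∉q with y FinP.≟ x
... | yes y≡x = y≡x
... | no y≢x = ⊥-elim (ℕP.<⇒≱ p-x-y<p (ℕP.≤-trans size (s≤s (p⊆q⇒∣p∣≤∣q∣ p∩q⊆p-x-y))))
  where
  p∩q⊆p-x-y : p ∩ q ⊆ (p - x) - y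
  p∩q⊆p-x-y {z} z∈p∩q with x∈p∩q⁻ p q z∈p∩q
  ... | z∈p , z∈q = x∈p∧x≢y⇒x∈p-y (x∈p∧x≢y⇒x∈p-y z∈p λ { refl → x∉q z∈q }) λ { refl → y∉q z∈q }
  p-x-y<p : suc ∣ (p - x) - y ∣ < ∣ p ∣
  p-x-y<p = ℕP.<-≤-trans (s≤s (x∈p⇒∣p-x∣<∣p∣ (x∈p∧x≢y⇒x∈p-y y∈p y≢x))) (x∈p⇒∣p-x∣<∣p∣ x∈p)

adj-swap : ∀ (G : Graph) {x y} → adj G x y ≡ true → adj G y x ≡ true
adj-swap G {x} {y} e = trans (adj-sym G y x) e

adj⇒≢ : ∀ (G : Graph) {x y} → adj G x y ≡ true → y ≢ x
adj⇒≢ G {x} e refl = false≢true (trans (sym (adj-irr G x)) e)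

neighbours-cases : ∀ (G : Graph) x →
  (∀ y → adj G x y ≢ true) ⊎
  (∃ λ c → adj G x c ≡ true × ∀ y → adj G x y ≡ true → y ≡ c) ⊎
  (∃₂ λ c₁ c₂ → adj G x c₁ ≡ true × adj G x c₂ ≡ true × c₁ ≢ c₂)
neighbours-cases G x with FinP.any? (λ y → adj G x y BoolP.≟ true)
... | no none = inj₁ λ y e → none (y , e)
... | yes (c₁ , e₁) with FinP.any? (λ y → (adj G x y BoolP.≟ true) ×-dec ¬? (y FinP.≟ c₁))
...   | yes (c₂ , e₂ , c₂≢c₁) = inj₂ (inj₂ (c₁ , c₂ , e₁ , e₂ , λ c₁≡c₂ → c₂≢c₁ (sym c₁≡c₂)))
...   | no  none = inj₂ (inj₁ (c₁ , e₁ , λ y e → decidable-stable (y FinP.≟ c₁) λ y≢c₁ → none (y , e , y≢c₁)))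

module _ {G : Graph} where

  snoc : ∀ {x y z} → Walk G x y → adj G y z ≡ true → Walk G x z
  snoc stop       e = step e stop
  snoc (step e′ w) e = step e′ (snoc w e)

  All-snoc : ∀ {P : Pred (Fin (n G)) 0ℓ} {x y z} (w : Walk G x y) (e : adj G y z ≡ true) →
             All P (verts w) → P z → All P (verts (snoc w e))
  All-snoc stop       e (px ∷ []) pz = px ∷ pz ∷ []
  All-snoc (step _ w) e (px ∷ pw) pz = px ∷ All-snoc w e pw pz

  head-∈ : ∀ {x y} (w : Walk G x y) → x ∈ₗ verts w
  head-∈ stop       = here refl
  head-∈ (step _ _) = here refl

  All-head : ∀ {P : Pred (Fin (n G)) 0ℓ} {x y} (w : Walk G x y) → All P (verts w) → P x
  All-head stop       (px ∷ _) = px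
  All-head (step _ _) (px ∷ _) = px

  All-last : ∀ {P : Pred (Fin (n G)) 0ℓ} {x y} (w : Walk G x y) → All P (verts w) → P y
  All-last stop       (py ∷ _)  = py
  All-last (step _ w) (_  ∷ pw) = All-last w pw

  suffix : ∀ {x y z} (w : Walk G x y) → z ∈ₗ verts w →
           Σ (Walk G z y) λ s → (Unique (verts w) → Unique (verts s)) × verts s ⊆ₗ verts w
  suffix stop       (here refl) = stop , id , id
  suffix (step e w) (here refl) = step e w , id , id
  suffix (step e w) (there z∈w) with suffix w z∈w
  ... | s , unique , s⊆w = s , (λ { (_ ∷ u) → unique u }) , there ∘ s⊆w

  open import Data.List.Membership.DecPropositional (FinP._≟_ {n G}) using () renaming (_∈?_ to _∈ₗ?_)

  loopErase : ∀ {x y} (w : Walk G x y) → Σ (Walk G x y) λ p → Unique (verts p) × verts p ⊆ₗ verts w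
  loopErase stop = stop , [] ∷ [] , id
  loopErase (step {x} e w) with loopErase w
  ... | p , unique , p⊆w with x ∈ₗ? verts p
  ...   | yes x∈p = let s , s-unique , s⊆p = suffix p x∈p in s , s-unique unique , there ∘ p⊆w ∘ s⊆p
  ...   | no  x∉p = step e p , AllP.¬Any⇒All¬ (verts p) x∉p ∷ unique ,
                    λ { (here eq) → here eq ; (there z∈p) → there (p⊆w z∈p) }

module _ {G H : Graph} (f : Fin (n G) → Fin (n H))
         (hom : ∀ {x y} → adj G x y ≡ true → adj H (f x) (f y) ≡ true) where

  mapWalk : ∀ {x y} → Walk G x y → Walk H (f x) (f y)
  mapWalk stop       = stop
  mapWalk (step e w) = step (hom e) (mapWalk w)

  verts-mapWalk : ∀ {x y} (w : Walk G x y) → verts (mapWalk w) ≡ map f (verts w)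
  verts-mapWalk stop       = refl
  verts-mapWalk (step e w) = cong (f _ ∷_) (verts-mapWalk w)

  len-mapWalk : ∀ {x y} (w : Walk G x y) → len (mapWalk w) ≡ len w
  len-mapWalk stop       = refl
  len-mapWalk (step e w) = cong suc (len-mapWalk w)

induced : (G : Graph) → Subset (n G) → Graph
induced G Q = record
  { n       = ∣ Q ∣
  ; adj     = λ x y → adj G (embed Q x) (embed Q y)
  ; adj-sym = λ x y → adj-sym G (embed Q x) (embed Q y)
  ; adj-irr = λ x → adj-irr G (embed Q x) }

module _ (G : Graph) (Q : Subset (n G)) where

  embedWalk : ∀ {x y} → Walk (induced G Q) x y → Walk G (embed Q x) (embed Q y)
  embedWalk = mapWalk (embed Q) id

  verts-embedWalk : ∀ {x y} (w : Walk (induced G Q) x y) → verts (embedWalk w) ≡ map (embed Q) (verts w)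
  verts-embedWalk = verts-mapWalk (embed Q) id

  embedWalk-unique : ∀ {x y} (w : Walk (induced G Q) x y) → Unique (verts w) → Unique (verts (embedWalk w))
  embedWalk-unique w u = subst Unique (sym (verts-embedWalk w)) (UniqueP.map⁺ (embed-injective Q) u)

  ∈-embedWalk⁻ : ∀ {x y s} (w : Walk (induced G Q) x y) → embed Q s ∈ₗ verts (embedWalk w) → s ∈ₗ verts w
  ∈-embedWalk⁻ w s∈w with ∈-map⁻ (embed Q) (subst (_ ∈ₗ_) (verts-embedWalk w) s∈w)
  ... | t , t∈w , eq = subst (_∈ₗ verts w) (sym (embed-injective Q eq)) t∈w

  liftWalk : ∀ {x′ y′ x y} (w : Walk G x y) → All (_∈ₛ Q) (verts w) → embed Q x′ ≡ x → embed Q y′ ≡ y →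
             Σ (Walk (induced G Q) x′ y′) λ w′ → map (embed Q) (verts w′) ≡ verts w
  liftWalk stop _ refl eq with embed-injective Q eq
  ... | refl = stop , refl
  liftWalk {x′} (step e w) (_ ∷ w⊆Q) refl eq with embed-surjective Q (All-head w w⊆Q)
  ... | z′ , refl with liftWalk w w⊆Q refl eq
  ... | w′ , vs = step e w′ , cong (embed Q x′ ∷_) vs

Acyclic-induced : ∀ G (Q : Subset (n G)) → Acyclic G → Acyclic (induced G Q)
Acyclic-induced G Q acyclic (x , y , w , e , unique , long) =
  acyclic (embed Q x , embed Q y , embedWalk G Q w , e , embedWalk-unique G Q w unique ,
           subst (2 ≤_) (sym (len-mapWalk (embed Q) id w)) long)

module RootedTree (T : Graph) (r : Fin (n T)) where

  open import Data.List.Membership.DecPropositional (FinP._≟_ {n T}) using () renaming (_∈?_ to _∈ₗ?_)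

  Closed : Pred (Fin (n T)) 0ℓ → Set
  Closed P = ∀ {t s} → P t → adj T t s ≡ true → s ≢ r → P s

  module _ {P : Pred (Fin (n T)) 0ℓ} (P-closed : Closed P) where

    Closed-walk : ∀ {a b} (w : Walk T a b) → All (r ≢_) (verts w) → P a → P b
    Closed-walk stop       _          pa = pa
    Closed-walk (step e w) (_ ∷ w≢r) pa = Closed-walk w w≢r (P-closed pa e λ s≡r → All-head w w≢r (sym s≡r))

    leaving-Closed-visits-root : ∀ {a b} (w : Walk T a b) → P a → ¬ P b → r ∈ₗ verts w
    leaving-Closed-visits-root w pa ¬pb with r ∈ₗ? verts w
    ... | yes r∈w = r∈w
    ... | no  r∉w = ⊥-elim (¬pb (Closed-walk w (AllP.¬Any⇒All¬ (verts w) r∉w) pa))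

  module Branches (X Y : Pred (Fin (n T)) 0ℓ) (X-closed : Closed X) (Y-closed : Closed Y)
                  (split : ∀ t → t ≡ r ⊎ X t ⊎ Y t) (disjoint : ∀ {t} → X t → Y t → ⊥)
                  (r∉Y : ¬ Y r) where

    RootOrX : Pred (Fin (n T)) 0ℓ
    RootOrX t = t ≡ r ⊎ X t

    -- a path can only enter Y through r, and can then only leave Y through r again
    path-stays-in-RootOrX : ∀ {a b} (p : Walk T a b) → Unique (verts p) → RootOrX a → RootOrX b →
                            All RootOrX (verts p)
    path-stays-in-RootOrX stop _ in-a _ = in-a ∷ []
    path-stays-in-RootOrX (step {y = y} e p) (a∉p ∷ unique) in-a in-b with split y
    ... | inj₁ y≡r       = in-a ∷ path-stays-in-RootOrX p unique (inj₁ y≡r) in-b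
    ... | inj₂ (inj₁ xy) = in-a ∷ path-stays-in-RootOrX p unique (inj₂ xy) in-b
    ... | inj₂ (inj₂ yy) with in-a
    ...   | inj₂ xa   = ⊥-elim (disjoint (X-closed xa e λ { refl → r∉Y yy }) yy)
    ...   | inj₁ refl with Closed-walk Y-closed p a∉p yy | in-b
    ...     | yb | inj₁ refl = ⊥-elim (r∉Y yb)
    ...     | yb | inj₂ xb   = ⊥-elim (disjoint xb yb)

  -- a path through a leaf root r enters and leaves r along the same edge
  path-avoids-leaf-root : ∀ c → (∀ x → adj T r x ≡ true → x ≡ c) →
                          ∀ {a b} (p : Walk T a b) → Unique (verts p) → a ≢ r → b ≢ r → All (_≢ r) (verts p)
  path-avoids-leaf-root c leaf stop _ a≢r _ = a≢r ∷ []
  path-avoids-leaf-root c leaf (step {y = y} e p) (_ ∷ unique) a≢r b≢r with y FinP.≟ r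
  ... | no y≢r = a≢r ∷ path-avoids-leaf-root c leaf p unique y≢r b≢r
  path-avoids-leaf-root c leaf (step e stop) _ _ b≢r | yes refl = ⊥-elim (b≢r refl)
  path-avoids-leaf-root c leaf (step {x = a} e (step {y = z} e′ p)) (a∉p ∷ _) _ _ | yes refl =
    ⊥-elim (All.lookup a∉p (there (head-∈ p)) (trans (leaf a (adj-swap T e)) (sym (leaf z e′))))

  -- the component of c in T minus r, as the limit of the breadth-first layers R j
  module Component (c : Fin (n T)) (c≢r : c ≢ r) where

    grow? : (R : Subset (n T)) → Decidable λ s → s ∈ₛ R ⊎ (s ≢ r × ∃ λ t → t ∈ₛ R × adj T t s ≡ true)
    grow? R s = (s ∈? R) ⊎-dec (¬? (s FinP.≟ r) ×-dec FinP.any? (λ t → (t ∈? R) ×-dec (adj T t s BoolP.≟ true)))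

    R : ℕ → Subset (n T)
    R zero    = ⁅ c ⁆
    R (suc j) = subsetOf (grow? (R j))

    R-mono : ∀ j {s} → s ∈ₛ R j → s ∈ₛ R (suc j)
    R-mono j s∈R = ∈-subsetOf⁺ (grow? (R j)) (inj₁ s∈R)

    R-step : ∀ j {t s} → t ∈ₛ R j → adj T t s ≡ true → s ≢ r → s ∈ₛ R (suc j)
    R-step j t∈R e s≢r = ∈-subsetOf⁺ (grow? (R j)) (inj₂ (s≢r , _ , t∈R , e))

    R-walk : ∀ j {s} → s ∈ₛ R j → Σ (Walk T c s) λ w → All (_∈ₛ R j) (verts w) × All (_≢ r) (verts w)
    R-walk zero s∈R with x∈⁅y⁆⇒x≡y c s∈R
    ... | refl = stop , s∈R ∷ [] , c≢r ∷ []
    R-walk (suc j) s∈R with ∈-subsetOf⁻ (grow? (R j)) s∈R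
    ... | inj₁ s∈R′ = let w , w⊆R , w≢r = R-walk j s∈R′ in w , All.map (R-mono j) w⊆R , w≢r
    ... | inj₂ (s≢r , t , t∈R , e) =
      let w , w⊆R , w≢r = R-walk j t∈R
      in snoc w e , All-snoc w e (All.map (R-mono j) w⊆R) s∈R , All-snoc w e w≢r s≢r

    -- a layer that is not yet closed has grown at every step
    closed-or-large : ∀ j → Closed (_∈ₛ R j) ⊎ suc j ≤ ∣ R j ∣
    closed-or-large zero = inj₂ (ℕP.≤-reflexive (sym (∣⁅x⁆∣≡1 c)))
    closed-or-large (suc j) with R (suc j) ⊆? R j
    ... | yes R′⊆R = inj₁ λ t∈R e s≢r → R-step j (R′⊆R t∈R) e s≢r
    ... | no R′⊈R with ⊈⇒∃∈∉ (R (suc j)) (R j) R′⊈R | closed-or-large j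
    ...   | x , x∈R′ , x∉R | inj₂ large = inj₂ (ℕP.≤-trans (s≤s large) (p⊂q⇒∣p∣<∣q∣ (R-mono j , x , x∈R′ , x∉R)))
    ...   | x , x∈R′ , x∉R | inj₁ closed with ∈-subsetOf⁻ (grow? (R j)) x∈R′
    ...     | inj₁ x∈R                  = ⊥-elim (x∉R x∈R)
    ...     | inj₂ (x≢r , t , t∈R , e) = ⊥-elim (x∉R (closed t∈R e x≢r))

    C : Subset (n T)
    C = R (n T)

    C-closed : Closed (_∈ₛ C)
    C-closed with closed-or-large (n T)
    ... | inj₁ closed = closed
    ... | inj₂ large  = ⊥-elim (ℕP.<⇒≱ large (∣p∣≤n C))

    C-walk : ∀ {s} → s ∈ₛ C → Σ (Walk T c s) λ w → All (_∈ₛ C) (verts w) × All (_≢ r) (verts w)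
    C-walk = R-walk (n T)

    c∈C : c ∈ₛ C
    c∈C = c∈R (n T)
      where
      c∈R : ∀ j → c ∈ₛ R j
      c∈R zero    = x∈⁅x⁆ c
      c∈R (suc j) = R-mono j (c∈R j)

    r∉C : r ∉ₛ C
    r∉C r∈C = let w , _ , w≢r = C-walk r∈C in All-last w w≢r refl

  neighbours-linked-only-via-root : Acyclic T → ∀ {c₁ c₂} → adj T r c₁ ≡ true → adj T r c₂ ≡ true → c₁ ≢ c₂ →
                                    (w : Walk T c₁ c₂) → ¬ All (_≢ r) (verts w)
  neighbours-linked-only-via-root acyclic {c₁} {c₂} r-c₁ r-c₂ c₁≢c₂ w w≢r =
    let p , unique , p⊆w = loopErase w
    in acyclic (c₂ , r , step r-c₁ p , adj-swap T r-c₂ ,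
                All.map (λ x≢r r≡x → x≢r (sym r≡x)) (AllP.anti-mono p⊆w w≢r) ∷ unique , s≤s (1≤len p c₁≢c₂))
    where
    1≤len : ∀ {a b} (p : Walk T a b) → a ≢ b → 1 ≤ len p
    1≤len stop       a≢a = ⊥-elim (a≢a refl)
    1≤len (step _ _) _   = s≤s z≤n

  module _ (Q : Subset (n T)) (ρ : Fin ∣ Q ∣) where

    induced-Child⇒Child : embed Q ρ ≡ r → ∀ {t s} → Child (induced T Q) ρ t s → Child T r (embed Q t) (embed Q s)
    induced-Child⇒Child refl (e , p , unique , s∉p) =
      e , embedWalk T Q p , embedWalk-unique T Q p unique , s∉p ∘ ∈-embedWalk⁻ T Q p

    induced-Child⇒Child-below : ∀ {c} → embed Q ρ ≡ c → adj T r c ≡ true → (∀ {x} → x ∈ₛ Q → x ≢ r) →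
                                ∀ {t s} → Child (induced T Q) ρ t s → Child T r (embed Q t) (embed Q s)
    induced-Child⇒Child-below refl erc Q∌r {t} {s} (e , p , unique , s∉p) =
      e , step erc (embedWalk T Q p) , r∉p ∷ embedWalk-unique T Q p unique , s∉r∷p
      where
      r∉p : All (r ≢_) (verts (embedWalk T Q p))
      r∉p = subst (All (r ≢_)) (sym (verts-embedWalk T Q p))
                  (AllP.map⁺ (All.tabulate {xs = verts p} λ {x} _ r≡x → Q∌r (embed-∈ Q x) (sym r≡x)))
      s∉r∷p : ¬ embed Q s ∈ₗ (r ∷ verts (embedWalk T Q p))
      s∉r∷p (here s≡r)  = Q∌r (embed-∈ Q s) s≡r
      s∉r∷p (there s∈p) = s∉p (∈-embedWalk⁻ T Q p s∈p)

module Restriction {k : ℕ} (F : DLab k) (D : TWDecomp k F) (Q : Subset (n (TWDecomp.T D))) where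
  open TWDecomp D

  S? : Decidable λ v → ∃ λ t → t ∈ₛ Q × v ∈ₛ β t
  S? v = FinP.any? λ t → (t ∈? Q) ×-dec (v ∈? β t)

  S : Subset (nV F)
  S = subsetOf S?

  S-∈⁻ : ∀ {v} → v ∈ₛ S → ∃ λ t → t ∈ₛ Q × v ∈ₛ β t
  S-∈⁻ = ∈-subsetOf⁻ S?

  S-∈⁺ : ∀ {v} t → t ∈ₛ Q → v ∈ₛ β t → v ∈ₛ S
  S-∈⁺ t t∈Q v∈β = ∈-subsetOf⁺ S? (t , t∈Q , v∈β)

  β⊆S : ∀ t → β (embed Q t) ⊆ S
  β⊆S t = S-∈⁺ (embed Q t) (embed-∈ Q t)

  β′ : Fin ∣ Q ∣ → Subset ∣ S ∣
  β′ t = restrict (β (embed Q t)) S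

  module Rerooted (ρ : Fin ∣ Q ∣) (lab′ : Fin k → Fin (nV F)) (lab′-injective : Injective _≡_ _≡_ lab′)
                  (root-bag′ : ∀ v → (v ∈ₛ β (embed Q ρ)) ⇔ (∃ λ i → lab′ i ≡ v))
                  (Q-convex : ∀ {a b} (p : Walk T a b) → Unique (verts p) → a ∈ₛ Q → b ∈ₛ Q →
                              All (_∈ₛ Q) (verts p))
                  (Q-cover-e : ∀ v w → v ∈ₛ S → w ∈ₛ S → adj (graph F) v w ≡ true →
                               ∃ λ t → t ∈ₛ Q × v ∈ₛ β t × w ∈ₛ β t)
                  (Child-lift : ∀ {t s} → Child (induced T Q) ρ t s → Child T root (embed Q t) (embed Q s)) where

    lab′-∈S : ∀ i → lab′ i ∈ₛ S
    lab′-∈S i = β⊆S ρ (Equivalence.from (root-bag′ (lab′ i)) (i , refl))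

    labS : Fin k → Fin ∣ S ∣
    labS i = proj₁ (embed-surjective S (lab′-∈S i))

    embed-labS : ∀ i → embed S (labS i) ≡ lab′ i
    embed-labS i = proj₂ (embed-surjective S (lab′-∈S i))

    labS-injective : Injective _≡_ _≡_ labS
    labS-injective {i} {j} eq =
      lab′-injective (trans (sym (embed-labS i)) (trans (cong (embed S) eq) (embed-labS j)))

    F′ : DLab k
    F′ = record { graph = induced (graph F) S ; lab = labS ; lab-inj = labS-injective }

    path-in-Q : ∀ {t t′} (w : Walk T t t′) → t ∈ₛ Q → t′ ∈ₛ Q →
                Σ (Walk T t t′) λ p → All (_∈ₛ Q) (verts p) × verts p ⊆ₗ verts w
    path-in-Q w t∈Q t′∈Q = let p , unique , p⊆w = loopErase w in p , Q-convex p unique t∈Q t′∈Q , p⊆w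

    F′-TW : TW k F′
    F′-TW = record
      { T        = induced T Q
      ; T-conn   = conn
      ; T-acyc   = Acyclic-induced T Q T-acyc
      ; β        = β′
      ; cover-v  = cover-v′
      ; cover-e  = cover-e′
      ; coherent = coherent′
      ; bag-size = λ t → trans (∣restrict∣≡ _ S (β⊆S t)) (bag-size (embed Q t))
      ; adj-size = adj-size′
      ; root     = ρ
      ; root-bag = root-bag″
      ; children = λ t (f , f-inj , child) →
          children (embed Q t) (embed Q ∘ f , f-inj ∘ embed-injective Q , Child-lift ∘ child)
      }
      where
      conn : Connected (induced T Q)
      conn t t′ with path-in-Q (T-conn (embed Q t) (embed Q t′)) (embed-∈ Q t) (embed-∈ Q t′)
      ... | p , p⊆Q , _ = proj₁ (liftWalk T Q p p⊆Q refl refl)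

      cover-v′ : ∀ j → ∃ λ t → j ∈ₛ β′ t
      cover-v′ j with S-∈⁻ (embed-∈ S j)
      ... | t , t∈Q , j∈β with embed-surjective Q t∈Q
      ... | t′ , refl = t′ , ∈-restrict⁺ _ S j j∈β

      cover-e′ : ∀ j j′ → adj (induced (graph F) S) j j′ ≡ true → ∃ λ t → j ∈ₛ β′ t × j′ ∈ₛ β′ t
      cover-e′ j j′ e with Q-cover-e (embed S j) (embed S j′) (embed-∈ S j) (embed-∈ S j′) e
      ... | t , t∈Q , j∈β , j′∈β with embed-surjective Q t∈Q
      ... | t′ , refl = t′ , ∈-restrict⁺ _ S j j∈β , ∈-restrict⁺ _ S j′ j′∈β

      coherent′ : ∀ j t t′ → j ∈ₛ β′ t → j ∈ₛ β′ t′ →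
                  Σ (Walk (induced T Q) t t′) λ p → All (λ s → j ∈ₛ β′ s) (verts p)
      coherent′ j t t′ j∈t j∈t′ with coherent (embed S j) (embed Q t) (embed Q t′)
                                              (∈-restrict⁻ _ S j j∈t) (∈-restrict⁻ _ S j j∈t′)
      ... | w , j∈w with path-in-Q w (embed-∈ Q t) (embed-∈ Q t′)
      ... | p , p⊆Q , p⊆w with liftWalk T Q p p⊆Q refl refl
      ... | p′ , p′↦p =
        p′ , All.map (∈-restrict⁺ _ S j) (AllP.map⁻ (subst (All _) (sym p′↦p) (AllP.anti-mono p⊆w j∈w)))

      adj-size′ : ∀ s t → adj (induced T Q) s t ≡ true → ∣ β′ s ∩ β′ t ∣ ≡ k ∸ 1
      adj-size′ s t e = begin
        ∣ β′ s ∩ β′ t ∣                              ≡⟨ cong ∣_∣ (restrict-∩ (β (embed Q s)) (β (embed Q t)) S) ⟨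
        ∣ restrict (β (embed Q s) ∩ β (embed Q t)) S ∣ ≡⟨ ∣restrict∣≡ _ S (β⊆S s ∘ proj₁ ∘ x∈p∩q⁻ _ _) ⟩
        ∣ β (embed Q s) ∩ β (embed Q t) ∣              ≡⟨ adj-size (embed Q s) (embed Q t) e ⟩
        k ∸ 1                                        ∎
        where open ≡-Reasoning

      root-bag″ : ∀ j → (j ∈ₛ β′ ρ) ⇔ (∃ λ i → labS i ≡ j)
      root-bag″ j = mk⇔ to from
        where
        to : j ∈ₛ β′ ρ → ∃ λ i → labS i ≡ j
        to j∈ρ with Equivalence.to (root-bag′ _) (∈-restrict⁻ _ S j j∈ρ)
        ... | i , eq = i , embed-injective S (trans (embed-labS i) eq)
        from : (∃ λ i → labS i ≡ j) → j ∈ₛ β′ ρ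
        from (i , refl) = ∈-restrict⁺ _ S (labS i)
          (subst (_∈ₛ β (embed Q ρ)) (sym (embed-labS i)) (Equivalence.from (root-bag′ _) (i , refl)))

module _ {k : ℕ} {G₁ G₂ : Gr} {a : Fin k → Gr.V G₁} {b : Fin k → Gr.V G₂} where
  open Gr
  open Push G₁ G₂ a b

  record PushoutCover (F : DLab k) : Set where
    field
      f₁ : V G₁ → Fin (nV F)
      f₂ : V G₂ → Fin (nV F)
      f₁-injective : Injective _≡_ _≡_ f₁
      f₂-injective : Injective _≡_ _≡_ f₂
      glue  : ∀ i → f₁ (a i) ≡ f₂ (b i)
      meet  : ∀ x y → f₁ x ≡ f₂ y → ∃ λ i → y ≡ b i
      cover : ∀ z → (∃ λ x → f₁ x ≡ z) ⊎ (∃ λ y → f₂ y ≡ z)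
      edge-split : ∀ z z′ → adj (graph F) z z′ ≡ true →
                   (∃₂ λ x y → f₁ x ≡ z × f₁ y ≡ z′ × E G₁ x y) ⊎ (∃₂ λ x y → f₂ x ≡ z × f₂ y ≡ z′ × E G₂ x y)
      f₁-edge : ∀ {x y} → E G₁ x y → adj (graph F) (f₁ x) (f₁ y) ≡ true
      f₂-edge : ∀ {x y} → E G₂ x y → adj (graph F) (f₂ x) (f₂ y) ≡ true

  ι₂-cases : ∀ v → (∃ λ i → v ≡ b i × ι₂ v ≡ inj₁ (a i)) ⊎ (Σ (∀ i → v ≢ b i) λ free → ι₂ v ≡ inj₂ (unl v free))
  ι₂-cases v with FinP.any? (λ i → dec G₂ v (b i))
  ... | yes (i , v≡bi) = inj₁ (i , v≡bi , refl)
  ... | no ¬glued      = inj₂ ((λ i v≡bi → ¬glued (i , v≡bi)) , refl)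

  module _ (b-injective : Injective _≡_ _≡_ b) where

    ι₂-glued : ∀ i → ι₂ (b i) ≡ inj₁ (a i)
    ι₂-glued i with ι₂-cases (b i)
    ... | inj₁ (j , bi≡bj , eq) = trans eq (cong (inj₁ ∘ a) (b-injective (sym bi≡bj)))
    ... | inj₂ (free , _)       = ⊥-elim (free i refl)

    PushoutCover⇒≅ : ∀ {F} (P : PushoutCover F) (ℓ : Fin k → V G₁) → (∀ i → PushoutCover.f₁ P (ℓ i) ≡ lab F i) →
                     F ≅ record { G = pushout ; lab = inj₁ ∘ ℓ }
    PushoutCover⇒≅ {F} P ℓ f₁-ℓ =
      mk↔ₛ′ to from to∘from from∘to , adj⇔EC , λ i → trans (cong to (sym (f₁-ℓ i))) (to-f₁ (ℓ i))
      where
      open PushoutCover P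

      to : Fin (nV F) → Carrier
      to z with cover z
      ... | inj₁ (x , _) = inj₁ x
      ... | inj₂ (y , _) = ι₂ y

      from : Carrier → Fin (nV F)
      from (inj₁ x)         = f₁ x
      from (inj₂ (unl v _)) = f₂ v

      from-ι₂ : ∀ y → from (ι₂ y) ≡ f₂ y
      from-ι₂ y with ι₂-cases y
      ... | inj₁ (i , refl , eq) rewrite eq = glue i
      ... | inj₂ (_ , eq)        rewrite eq = refl

      from∘to : ∀ z → from (to z) ≡ z
      from∘to z with cover z
      ... | inj₁ (x , f₁x≡z) = f₁x≡z
      ... | inj₂ (y , f₂y≡z) = trans (from-ι₂ y) f₂y≡z

      to-f₁ : ∀ x → to (f₁ x) ≡ inj₁ x
      to-f₁ x with cover (f₁ x)
      ... | inj₁ (x′ , eq) = cong inj₁ (f₁-injective eq)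
      ... | inj₂ (y , eq) with meet x y (sym eq)
      ...   | i , refl = trans (ι₂-glued i) (cong inj₁ (f₁-injective (trans (glue i) eq)))

      to-f₂ : ∀ y → to (f₂ y) ≡ ι₂ y
      to-f₂ y with cover (f₂ y)
      ... | inj₂ (y′ , eq) = cong ι₂ (f₂-injective eq)
      ... | inj₁ (x , eq) with meet x y eq
      ...   | i , refl = trans (cong inj₁ (f₁-injective (trans eq (sym (glue i))))) (sym (ι₂-glued i))

      to∘from : ∀ p → to (from p) ≡ p
      to∘from (inj₁ x) = to-f₁ x
      to∘from (inj₂ (unl v free)) with ι₂-cases v
      ... | inj₁ (i , v≡bi , _) = Irrelevant.⊥-elim (free i v≡bi)
      ... | inj₂ (_ , eq)       = trans (to-f₂ v) eq

      Adj : Fin (nV F) → Fin (nV F) → Set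
      Adj z z′ = adj (graph F) z z′ ≡ true

      adj⇔EC : ∀ z z′ → Adj z z′ ⇔ EC (to z) (to z′)
      adj⇔EC z z′ = mk⇔ forth back
        where
        forth : Adj z z′ → EC (to z) (to z′)
        forth e with edge-split z z′ e
        ... | inj₁ (x , y , refl , refl , xy) = inj₁ (x , y , sym (to-f₁ x) , sym (to-f₁ y) , xy)
        ... | inj₂ (x , y , refl , refl , xy) = inj₂ (x , y , sym (to-f₂ x) , sym (to-f₂ y) , xy)
        back : EC (to z) (to z′) → Adj z z′
        back (inj₁ (x , y , ex , ey , xy)) =
          subst₂ Adj (trans (cong from ex) (from∘to z)) (trans (cong from ey) (from∘to z′)) (f₁-edge xy)
        back (inj₂ (x , y , ex , ey , xy)) =
          subst₂ Adj (trans (sym (from-ι₂ x)) (trans (cong from ex) (from∘to z)))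
                     (trans (sym (from-ι₂ y)) (trans (cong from ey) (from∘to z′))) (f₂-edge xy)

-- edges G unfolds to edgeCount (adj G)
edgeCount : ∀ {m} → (Fin m → Fin m → Bool) → ℕ
edgeCount {m} a = sum (map (λ x → sum (map (λ y → if ⌊ x Fin.<? y ⌋ ∧ a x y then 1 else 0) (allFin m))) (allFin m))

sum-map-mono-≤ : ∀ {A : Set} {f g : A → ℕ} → (∀ x → f x ≤ g x) → ∀ xs → sum (map f xs) ≤ sum (map g xs)
sum-map-mono-≤ f≤g []       = z≤n
sum-map-mono-≤ f≤g (x ∷ xs) = ℕP.+-mono-≤ (f≤g x) (sum-map-mono-≤ f≤g xs)

sum-map-mono-< : ∀ {A : Set} {f g : A → ℕ} → (∀ x → f x ≤ g x) → ∀ {x} xs → x ∈ₗ xs → f x < g x →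
                 sum (map f xs) < sum (map g xs)
sum-map-mono-< f≤g (y ∷ xs) (here refl) lt = ℕP.+-mono-<-≤ lt (sum-map-mono-≤ f≤g xs)
sum-map-mono-< f≤g (y ∷ xs) (there x∈) lt = ℕP.+-mono-≤-< (f≤g y) (sum-map-mono-< f≤g xs x∈ lt)

edgeCount-< : ∀ {m} (a a′ : Fin m → Fin m → Bool) → (∀ x y → a′ x y ≡ true → a x y ≡ true) →
              ∀ {p q} → p <ᶠ q → a′ p q ≡ false → a p q ≡ true → edgeCount a′ < edgeCount a
edgeCount-< {m} a a′ a′⊆a {p} {q} p<q a′pq a-pq =
  sum-map-mono-< row-≤ (allFin m) (∈-allFin p) (sum-map-mono-< (entry-≤ p) (allFin m) (∈-allFin q) entry-<)
  where
  entry : (Fin m → Fin m → Bool) → Fin m → Fin m → ℕ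
  entry b x y = if ⌊ x Fin.<? y ⌋ ∧ b x y then 1 else 0

  entry-≤ : ∀ x y → entry a′ x y ≤ entry a x y
  entry-≤ x y with ⌊ x Fin.<? y ⌋ | a′ x y in a′xy
  ... | false | _     = z≤n
  ... | true  | false = z≤n
  ... | true  | true  rewrite a′⊆a x y a′xy = ℕP.≤-refl

  row-≤ : ∀ x → sum (map (entry a′ x) (allFin m)) ≤ sum (map (entry a x) (allFin m))
  row-≤ x = sum-map-mono-≤ (entry-≤ x) (allFin m)

  entry-< : entry a′ p q < entry a p q
  entry-< with p Fin.<? q
  ... | no p≮q = ⊥-elim (p≮q p<q)
  ... | yes _  rewrite a′pq | a-pq = s≤s z≤n

module _ (G : Graph) (u v : Fin (n G)) where

  isUV : Fin (n G) → Fin (n G) → Bool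
  isUV x y = (⌊ x FinP.≟ u ⌋ ∧ ⌊ y FinP.≟ v ⌋) ∨ (⌊ x FinP.≟ v ⌋ ∧ ⌊ y FinP.≟ u ⌋)

  isUV-sym : ∀ x y → isUV y x ≡ isUV x y
  isUV-sym x y = trans (cong₂ _∨_ (BoolP.∧-comm ⌊ y FinP.≟ u ⌋ ⌊ x FinP.≟ v ⌋)
                                  (BoolP.∧-comm ⌊ y FinP.≟ v ⌋ ⌊ x FinP.≟ u ⌋))
                       (BoolP.∨-comm (⌊ x FinP.≟ v ⌋ ∧ ⌊ y FinP.≟ u ⌋) (⌊ x FinP.≟ u ⌋ ∧ ⌊ y FinP.≟ v ⌋))

  isUV-true : ∀ x y → isUV x y ≡ true → (x ≡ u × y ≡ v) ⊎ (x ≡ v × y ≡ u)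
  isUV-true x y eq with x FinP.≟ u | y FinP.≟ v | x FinP.≟ v | y FinP.≟ u
  ... | yes x≡u | yes y≡v | _       | _       = inj₁ (x≡u , y≡v)
  ... | _       | _       | yes x≡v | yes y≡u = inj₂ (x≡v , y≡u)
  ... | yes _   | no  _   | no  _   | _       = ⊥-elim (false≢true eq)
  ... | yes _   | no  _   | yes _   | no  _   = ⊥-elim (false≢true eq)
  ... | no  _   | _       | no  _   | _       = ⊥-elim (false≢true eq)
  ... | no  _   | _       | yes _   | no  _   = ⊥-elim (false≢true eq)

  isUV-uv : isUV u v ≡ true
  isUV-uv with u FinP.≟ u | v FinP.≟ v
  ... | yes _   | yes _   = refl
  ... | no  u≢u | _       = ⊥-elim (u≢u refl)
  ... | yes _   | no  v≢v = ⊥-elim (v≢v refl)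

  deleteEdge : Graph
  deleteEdge = record
    { n       = n G
    ; adj     = λ x y → not (isUV x y) ∧ adj G x y
    ; adj-sym = λ x y → cong₂ (λ b c → not b ∧ c) (sym (isUV-sym x y)) (adj-sym G x y)
    ; adj-irr = λ x → trans (cong (not (isUV x x) ∧_) (adj-irr G x)) (BoolP.∧-zeroʳ _) }

  deleteEdge-⊆ : ∀ x y → adj deleteEdge x y ≡ true → adj G x y ≡ true
  deleteEdge-⊆ x y with isUV x y
  ... | false = id
  ... | true  = λ ()

  adj⇒deleteEdge⊎uv : ∀ x y → adj G x y ≡ true → adj deleteEdge x y ≡ true ⊎ (x ≡ u × y ≡ v) ⊎ (x ≡ v × y ≡ u)
  adj⇒deleteEdge⊎uv x y e with isUV x y in uv
  ... | false = inj₁ e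
  ... | true  = inj₂ (isUV-true x y uv)

  edges-deleteEdge-< : adj G u v ≡ true → edges deleteEdge < edges G
  edges-deleteEdge-< e with FinP.<-cmp u v
  ... | tri< u<v _ _ = edgeCount-< (adj G) (adj deleteEdge) deleteEdge-⊆ u<v
                         (cong (λ b → not b ∧ adj G u v) isUV-uv) e
  ... | tri≈ _ refl _ = ⊥-elim (false≢true (trans (sym (adj-irr G u)) e))
  ... | tri> _ _ v<u = edgeCount-< (adj G) (adj deleteEdge) deleteEdge-⊆ v<u
                         (cong (λ b → not b ∧ adj G v u) (trans (isUV-sym u v) isUV-uv)) (adj-swap G e)

NoLabelEdge : ∀ {k} → DLab k → Set
NoLabelEdge {k} F = ∀ (i j : Fin k) → adj (graph F) (lab F i) (lab F j) ≢ true

labelEdge? : ∀ {k} (F : DLab k) → (∃₂ λ i j → i <ᶠ j × adj (graph F) (lab F i) (lab F j) ≡ true) ⊎ NoLabelEdge F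
labelEdge? F with FinP.any? (λ i → FinP.any? (λ j → adj (graph F) (lab F i) (lab F j) BoolP.≟ true))
... | no none = inj₂ λ i j e → none (i , j , e)
... | yes (i , j , e) with FinP.<-cmp i j
...   | tri< i<j _ _  = inj₁ (i , j , i<j , e)
...   | tri≈ _ refl _ = ⊥-elim (adj⇒≢ (graph F) e refl)
...   | tri> _ _ j<i  = inj₁ (j , i , j<i , adj-swap (graph F) e)

module Bags {k : ℕ} {F : DLab k} (D : TWDecomp k F) where
  open TWDecomp D

  root-bag⁻ : ∀ {v} → v ∈ₛ β root → ∃ λ i → lab F i ≡ v
  root-bag⁻ = Equivalence.to (root-bag _)

  root-bag⁺ : ∀ i → lab F i ∈ₛ β root
  root-bag⁺ i = Equivalence.from (root-bag (lab F i)) (i , refl)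

  no-edge-in-root-bag : NoLabelEdge F → ∀ {v w} → v ∈ₛ β root → w ∈ₛ β root → adj (graph F) v w ≢ true
  no-edge-in-root-bag none v∈r w∈r with root-bag⁻ v∈r | root-bag⁻ w∈r
  ... | i , refl | j , refl = none i j

  ∃-∈-∉-adjacent : 1 ≤ k → ∀ {s t} → adj T s t ≡ true → ∃ λ x → x ∈ₛ β s × x ∉ₛ β t
  ∃-∈-∉-adjacent (s≤s _) {s} {t} e =
    ∣p∩q∣<∣p∣⇒∃∈∉ (β s) (β t) (subst₂ _<_ (sym (adj-size s t e)) (sym (bag-size s)) (ℕP.n<1+n _))

  ∉-unique-adjacent : ∀ {s t} → adj T s t ≡ true → ∀ {x y} → x ∈ₛ β s → x ∉ₛ β t → y ∈ₛ β s → y ∉ₛ β t → y ≡ x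
  ∉-unique-adjacent {s} {t} e =
    ∉-unique (β s) (β t) (subst₂ (λ a b → a ≤ suc b) (sym (bag-size s)) (sym (adj-size s t e)) (ℕP.m≤n+m∸n k 1))

SplitsOffEdges : ∀ k → DLab k → Set
SplitsOffEdges k F = Σ (List (Fin k × Fin k)) λ A → IsPairSet A × Σ (DLab k) λ F′ →
                       TW k F′ × nE F′ < nE F × F ≅ (prodA k A · toL F′)

SplitsOffVertex : ∀ k → DLab k → Set
SplitsOffVertex k F = Σ (Fin k) λ i → Σ (DLab k) λ F′ → TW k F′ × nV F′ < nV F × F ≅ (𝐉 k i · toL F′)

IsGluing : ∀ k → DLab k → Set
IsGluing k F = Σ (DLab k) λ F₁ → Σ (DLab k) λ F₂ →
                 TW k F₁ × TW k F₂ × nV F₁ < nV F × nV F₂ < nV F × F ≅ (toL F₁ ⊙ toL F₂)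

module _ {k : ℕ} (F : DLab k) (D : TWDecomp k F) where
  open TWDecomp D
  open Bags D

  ≅𝟏-if-root-isolated : NoLabelEdge F → (∀ t → adj T root t ≢ true) → F ≅ 𝟏 k
  ≅𝟏-if-root-isolated none isolated = mk↔ₛ′ index (lab F) index-lab lab-index , adj⇔⊥ , index-lab
    where
    only-root : ∀ t → t ≡ root
    only-root t with T-conn root t
    ... | stop     = refl
    ... | step e _ = ⊥-elim (isolated _ e)

    in-root : ∀ z → z ∈ₛ β root
    in-root z = let t , z∈t = cover-v z in subst (λ t → z ∈ₛ β t) (only-root t) z∈t

    index : Fin (nV F) → Fin k
    index z = proj₁ (root-bag⁻ (in-root z))

    lab-index : ∀ z → lab F (index z) ≡ z
    lab-index z = proj₂ (root-bag⁻ (in-root z))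

    index-lab : ∀ i → index (lab F i) ≡ i
    index-lab i = lab-inj F (lab-index (lab F i))

    adj⇔⊥ : ∀ z z′ → (adj (graph F) z z′ ≡ true) ⇔ ⊥
    adj⇔⊥ z z′ = mk⇔ (no-edge-in-root-bag none (in-root z) (in-root z′)) λ ()

  splitOffLabelEdge : ∀ i j → i <ᶠ j → adj (graph F) (lab F i) (lab F j) ≡ true → SplitsOffEdges k F
  splitOffLabelEdge i j i<j e =
    (i , j) ∷ [] , (i<j ∷ [] , [] ∷ []) , F′ , F′-TW , edges-deleteEdge-< (graph F) u v e ,
    PushoutCover⇒≅ (lab-inj F) cover inj₁ λ _ → refl
    where
    u v : Fin (nV F)
    u = lab F i
    v = lab F j

    F′ : DLab k
    F′ = record { graph = deleteEdge (graph F) u v ; lab = lab F ; lab-inj = lab-inj F }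

    F′-TW : TW k F′
    F′-TW = record
      { T = T ; T-conn = T-conn ; T-acyc = T-acyc ; β = β ; cover-v = cover-v
      ; cover-e = λ x y e → cover-e x y (deleteEdge-⊆ (graph F) u v x y e)
      ; coherent = coherent ; bag-size = bag-size ; adj-size = adj-size
      ; root = root ; root-bag = root-bag ; children = children }

    K : BGr k
    K = 𝐀 k i j ∙ 𝐈 k

    -- the unlabelled part of K is empty, as every vertex of 𝐈 k is an in-label
    f₁ : Gr.V (BGr.G K) → Fin (nV F)
    f₁ (inj₁ l)                = lab F l
    f₁ (inj₂ (Push.unl x free)) = Irrelevant.⊥-elim (free x refl)

    f₁-injective : Injective _≡_ _≡_ f₁
    f₁-injective {inj₁ l} {inj₁ l′} eq = cong inj₁ (lab-inj F eq)
    f₁-injective {inj₁ _} {inj₂ (Push.unl x free)} _ = Irrelevant.⊥-elim (free x refl)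
    f₁-injective {inj₂ (Push.unl x free)}          _ = Irrelevant.⊥-elim (free x refl)

    cover : PushoutCover F
    cover = record
      { f₁ = f₁ ; f₂ = id ; f₁-injective = f₁-injective ; f₂-injective = id
      ; glue = λ l → cong f₁ (ι₂-glued {G₁ = BGr.G (𝐀 k i j)} {G₂ = BGr.G (𝐈 k)} id l)
      ; meet = λ { (inj₁ l) y eq → l , sym eq ; (inj₂ (Push.unl x free)) _ _ → Irrelevant.⊥-elim (free x refl) }
      ; cover = λ z → inj₂ (z , refl)
      ; edge-split = edge-split
      ; f₁-edge = f₁-edge
      ; f₂-edge = λ {x} {y} → deleteEdge-⊆ (graph F) u v x y }
      where
      edge-split : ∀ z z′ → adj (graph F) z z′ ≡ true → _
      edge-split z z′ e with adj⇒deleteEdge⊎uv (graph F) u v z z′ e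
      ... | inj₁ e′                  = inj₂ (z , z′ , refl , refl , e′)
      ... | inj₂ (inj₁ (refl , refl)) =
        inj₁ (inj₁ i , inj₁ j , refl , refl , inj₁ (i , j , refl , refl , inj₁ (refl , refl)))
      ... | inj₂ (inj₂ (refl , refl)) =
        inj₁ (inj₁ j , inj₁ i , refl , refl , inj₁ (j , i , refl , refl , inj₂ (refl , refl)))

      f₁-edge : ∀ {x y} → Gr.E (BGr.G K) x y → adj (graph F) (f₁ x) (f₁ y) ≡ true
      f₁-edge (inj₁ (_ , _ , refl , refl , inj₁ (refl , refl))) = e
      f₁-edge (inj₁ (_ , _ , refl , refl , inj₂ (refl , refl))) = adj-swap (graph F) e
      f₁-edge (inj₂ (_ , _ , _ , _ , ()))

  -- u becomes the vertex î of 𝐉, and w takes over its label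
  module LeafRoot (none : NoLabelEdge F) (c : Fin (n T)) (r-c : adj T root c ≡ true)
                  (leaf : ∀ t → adj T root t ≡ true → t ≡ c) {u w : Fin (nV F)}
                  (u∈r : u ∈ₛ β root) (u∉c : u ∉ₛ β c) (w∈c : w ∈ₛ β c) (w∉r : w ∉ₛ β root) where
    r : Fin (n T)
    r = root

    i : Fin k
    i = proj₁ (root-bag⁻ u∈r)

    lab-i : lab F i ≡ u
    lab-i = proj₂ (root-bag⁻ u∈r)

    β-r⊆β-c : ∀ {x} → x ∈ₛ β r → x ≢ u → x ∈ₛ β c
    β-r⊆β-c {x} x∈r x≢u with x ∈? β c
    ... | yes x∈c = x∈c
    ... | no  x∉c = ⊥-elim (x≢u (∉-unique-adjacent r-c u∈r u∉c x∈r x∉c))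

    β-c⊆β-r : ∀ {x} → x ∈ₛ β c → x ∉ₛ β r → x ≡ w
    β-c⊆β-r x∈c x∉r = ∉-unique-adjacent (adj-swap T r-c) w∈c w∉r x∈c x∉r

    u-only-in-root : ∀ {t} → u ∈ₛ β t → t ≡ r
    u-only-in-root {t} u∈t with coherent u r t u∈r u∈t
    ... | stop , _ = refl
    ... | step e p , _ ∷ u∈p with leaf _ e
    ...   | refl = ⊥-elim (u∉c (All-head p u∈p))

    u-isolated : ∀ z → adj (graph F) u z ≢ true
    u-isolated z e with cover-e u z e
    ... | t , u∈t , z∈t with u-only-in-root u∈t
    ...   | refl = no-edge-in-root-bag none u∈t z∈t e

    f₁ : Maybe (Fin k) → Fin (nV F)
    f₁ (just l) = lab F l
    f₁ nothing  = w

    f₁-injective : Injective _≡_ _≡_ f₁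
    f₁-injective {just l}  {just l′}  eq = cong just (lab-inj F eq)
    f₁-injective {just l}  {nothing}  eq = ⊥-elim (w∉r (subst (_∈ₛ β r) eq (root-bag⁺ l)))
    f₁-injective {nothing} {just l}   eq = ⊥-elim (w∉r (subst (_∈ₛ β r) (sym eq) (root-bag⁺ l)))
    f₁-injective {nothing} {nothing}  _  = refl

    lab′ : Fin k → Fin (nV F)
    lab′ = f₁ ∘ BGr.outl (𝐉 k i)

    lab′-i : lab′ i ≡ w
    lab′-i with i FinP.≟ i
    ... | yes _   = refl
    ... | no  i≢i = ⊥-elim (i≢i refl)

    lab′-≢i : ∀ {l} → l ≢ i → lab′ l ≡ lab F l
    lab′-≢i {l} l≢i with l FinP.≟ i
    ... | yes l≡i = ⊥-elim (l≢i l≡i)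
    ... | no  _   = refl

    lab′-injective : Injective _≡_ _≡_ lab′
    lab′-injective {l} {l′} eq with l FinP.≟ i | l′ FinP.≟ i
    ... | yes l≡i | yes l′≡i = trans l≡i (sym l′≡i)
    ... | yes _   | no  _    = ⊥-elim (w∉r (subst (_∈ₛ β r) (sym eq) (root-bag⁺ l′)))
    ... | no  _   | yes _    = ⊥-elim (w∉r (subst (_∈ₛ β r) eq (root-bag⁺ l)))
    ... | no  _   | no  _    = lab-inj F eq

    root-bag′ : ∀ v → (v ∈ₛ β c) ⇔ (∃ λ l → lab′ l ≡ v)
    root-bag′ v = mk⇔ to from
      where
      to : v ∈ₛ β c → ∃ λ l → lab′ l ≡ v
      to v∈c with v ∈? β r
      ... | no  v∉r = i , trans lab′-i (sym (β-c⊆β-r v∈c v∉r))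
      ... | yes v∈r with root-bag⁻ v∈r
      ...   | l , refl with l FinP.≟ i
      ...     | yes refl = ⊥-elim (u∉c (subst (_∈ₛ β c) lab-i v∈c))
      ...     | no  l≢i  = l , lab′-≢i l≢i
      from : (∃ λ l → lab′ l ≡ v) → v ∈ₛ β c
      from (l , refl) with l FinP.≟ i
      ... | yes _   = w∈c
      ... | no  l≢i = β-r⊆β-c (root-bag⁺ l) λ eq → l≢i (lab-inj F (trans eq (sym lab-i)))

    Q? : Decidable (_≢ r)
    Q? t = ¬? (t FinP.≟ r)

    Q : Subset (n T)
    Q = subsetOf Q?

    c∈Q : c ∈ₛ Q
    c∈Q = ∈-subsetOf⁺ Q? (adj⇒≢ T r-c)

    open Restriction F D Q public

    ρ : Fin ∣ Q ∣
    ρ = proj₁ (embed-surjective Q c∈Q)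

    ρ↦c : embed Q ρ ≡ c
    ρ↦c = proj₂ (embed-surjective Q c∈Q)

    Q-convex : ∀ {a b} (p : Walk T a b) → Unique (verts p) → a ∈ₛ Q → b ∈ₛ Q → All (_∈ₛ Q) (verts p)
    Q-convex p unique a∈Q b∈Q =
      All.map (∈-subsetOf⁺ Q?)
              (RootedTree.path-avoids-leaf-root T r c leaf p unique (∈-subsetOf⁻ Q? a∈Q) (∈-subsetOf⁻ Q? b∈Q))

    Q-cover-e : ∀ v v′ → v ∈ₛ S → v′ ∈ₛ S → adj (graph F) v v′ ≡ true → ∃ λ t → t ∈ₛ Q × v ∈ₛ β t × v′ ∈ₛ β t
    Q-cover-e v v′ _ _ e with cover-e v v′ e
    ... | t , v∈t , v′∈t with t FinP.≟ r
    ...   | no  t≢r = t , ∈-subsetOf⁺ Q? t≢r , v∈t , v′∈t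
    ...   | yes refl = ⊥-elim (no-edge-in-root-bag none v∈t v′∈t e)

    open Rerooted ρ lab′ lab′-injective (subst (λ t → ∀ v → (v ∈ₛ β t) ⇔ (∃ λ l → lab′ l ≡ v)) (sym ρ↦c) root-bag′)
                  Q-convex Q-cover-e (RootedTree.induced-Child⇒Child-below T r Q ρ ρ↦c r-c (∈-subsetOf⁻ Q?)) public

    u∉S : u ∉ₛ S
    u∉S u∈S = let t , t∈Q , u∈t = S-∈⁻ u∈S in ∈-subsetOf⁻ Q? t∈Q (u-only-in-root u∈t)

    ≢u⇒∈S : ∀ {z} → z ≢ u → z ∈ₛ S
    ≢u⇒∈S {z} z≢u with cover-v z
    ... | t , z∈t with t FinP.≟ r
    ...   | no  t≢r  = S-∈⁺ t (∈-subsetOf⁺ Q? t≢r) z∈t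
    ...   | yes refl = S-∈⁺ c c∈Q (β-r⊆β-c z∈t z≢u)

    f₁∈S⇒lab′ : ∀ x → f₁ x ∈ₛ S → ∃ λ l → f₁ x ≡ lab′ l
    f₁∈S⇒lab′ nothing  _ = i , sym lab′-i
    f₁∈S⇒lab′ (just l) l∈S with l FinP.≟ i
    ... | yes refl = ⊥-elim (u∉S (subst (_∈ₛ S) lab-i l∈S))
    ... | no  l≢i  = l , sym (lab′-≢i l≢i)

    pushoutCover : PushoutCover {G₁ = BGr.G (𝐉 k i)} {G₂ = toGr (graph F′)} {a = BGr.outl (𝐉 k i)} {b = labS} F
    pushoutCover = record
      { f₁ = f₁ ; f₂ = embed S ; f₁-injective = f₁-injective ; f₂-injective = embed-injective S
      ; glue = λ l → sym (embed-labS l)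
      ; meet = meet
      ; cover = cover
      ; edge-split = edge-split
      ; f₁-edge = λ ()
      ; f₂-edge = id }
      where
      meet : ∀ x y → f₁ x ≡ embed S y → ∃ λ l → y ≡ labS l
      meet x y eq with f₁∈S⇒lab′ x (subst (_∈ₛ S) (sym eq) (embed-∈ S y))
      ... | l , eq′ = l , embed-injective S (trans (sym eq) (trans eq′ (sym (embed-labS l))))

      cover : ∀ z → (∃ λ x → f₁ x ≡ z) ⊎ (∃ λ y → embed S y ≡ z)
      cover z with z FinP.≟ u
      ... | yes refl = inj₁ (just i , lab-i)
      ... | no  z≢u  = inj₂ (embed-surjective S (≢u⇒∈S z≢u))

      edge-split : ∀ z z′ → adj (graph F) z z′ ≡ true → _
      edge-split z z′ e with z FinP.≟ u | z′ FinP.≟ u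
      ... | yes refl | _        = ⊥-elim (u-isolated z′ e)
      ... | no  _    | yes refl = ⊥-elim (u-isolated z (adj-swap (graph F) e))
      ... | no  z≢u  | no  z′≢u with embed-surjective S (≢u⇒∈S z≢u) | embed-surjective S (≢u⇒∈S z′≢u)
      ...   | y , refl | y′ , refl = inj₂ (y , y′ , refl , refl , e)

  splitOffVertex-at-leaf-root : 1 ≤ k → NoLabelEdge F → ∀ c → adj T root c ≡ true →
                                (∀ t → adj T root t ≡ true → t ≡ c) → SplitsOffVertex k F
  splitOffVertex-at-leaf-root k≥1 none c r-c leaf
    with ∃-∈-∉-adjacent k≥1 r-c | ∃-∈-∉-adjacent k≥1 (adj-swap T r-c)
  ... | u , u∈r , u∉c | w , w∈c , w∉r =
    i , F′ , F′-TW , x∉p⇒∣p∣<m S u u∉S , PushoutCover⇒≅ labS-injective pushoutCover just λ _ → refl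
    where open LeafRoot none c r-c leaf u∈r u∉c w∈c w∉r

  -- the part of the decomposition on the root together with one side X of a split of T minus the root
  module Half (X Y : Pred (Fin (n T)) 0ℓ) (X? : Decidable X)
              (X-closed : RootedTree.Closed T root X) (Y-closed : RootedTree.Closed T root Y)
              (split : ∀ t → t ≡ root ⊎ X t ⊎ Y t) (disjoint : ∀ {t} → X t → Y t → ⊥) (root∉Y : ¬ Y root) where
    open RootedTree T root
    open Branches X Y X-closed Y-closed split disjoint root∉Y

    Q? : Decidable RootOrX
    Q? t = (t FinP.≟ root) ⊎-dec X? t

    Q : Subset (n T)
    Q = subsetOf Q?

    open Restriction F D Q public

    ρ : Fin ∣ Q ∣
    ρ = proj₁ (embed-surjective Q (∈-subsetOf⁺ Q? (inj₁ refl)))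

    ρ↦root : embed Q ρ ≡ root
    ρ↦root = proj₂ (embed-surjective Q (∈-subsetOf⁺ Q? (inj₁ refl)))

    ∉Q⇒Y : ∀ {t} → t ∉ₛ Q → Y t
    ∉Q⇒Y {t} t∉Q with split t
    ... | inj₁ t≡r       = ⊥-elim (t∉Q (∈-subsetOf⁺ Q? (inj₁ t≡r)))
    ... | inj₂ (inj₁ xt) = ⊥-elim (t∉Q (∈-subsetOf⁺ Q? (inj₂ xt)))
    ... | inj₂ (inj₂ yt) = yt

    -- the bags containing v form a subtree, which must pass through the root to reach Q
    Y-bag∩S⊆root-bag : ∀ {v t} → v ∈ₛ S → Y t → v ∈ₛ β t → v ∈ₛ β root
    Y-bag∩S⊆root-bag {v} {t} v∈S yt v∈t with S-∈⁻ v∈S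
    ... | t′ , t′∈Q , v∈t′ with coherent v t t′ v∈t v∈t′
    ...   | w , v∈w = All.lookup v∈w (leaving-Closed-visits-root Y-closed w yt ¬yt′)
      where
      ¬yt′ : ¬ Y t′
      ¬yt′ yt′ with ∈-subsetOf⁻ Q? t′∈Q
      ... | inj₁ refl = root∉Y yt′
      ... | inj₂ xt′  = disjoint xt′ yt′

    Q-convex : ∀ {a b} (p : Walk T a b) → Unique (verts p) → a ∈ₛ Q → b ∈ₛ Q → All (_∈ₛ Q) (verts p)
    Q-convex p unique a∈Q b∈Q =
      All.map (∈-subsetOf⁺ Q?) (path-stays-in-RootOrX p unique (∈-subsetOf⁻ Q? a∈Q) (∈-subsetOf⁻ Q? b∈Q))

    Q-cover-e : ∀ v v′ → v ∈ₛ S → v′ ∈ₛ S → adj (graph F) v v′ ≡ true → ∃ λ t → t ∈ₛ Q × v ∈ₛ β t × v′ ∈ₛ β t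
    Q-cover-e v v′ v∈S v′∈S e with cover-e v v′ e
    ... | t , v∈t , v′∈t with t ∈? Q
    ...   | yes t∈Q = t , t∈Q , v∈t , v′∈t
    ...   | no  t∉Q = root , ∈-subsetOf⁺ Q? (inj₁ refl) ,
                      Y-bag∩S⊆root-bag v∈S (∉Q⇒Y t∉Q) v∈t , Y-bag∩S⊆root-bag v′∈S (∉Q⇒Y t∉Q) v′∈t

    open Rerooted ρ (lab F) (lab-inj F) (subst (λ t → ∀ v → (v ∈ₛ β t) ⇔ _) (sym ρ↦root) root-bag)
                  Q-convex Q-cover-e (induced-Child⇒Child Q ρ ρ↦root) public

    fewer-vertices : ∀ {x t} → Y t → x ∈ₛ β t → x ∉ₛ β root → nV F′ < nV F
    fewer-vertices yt x∈t x∉r = x∉p⇒∣p∣<m S _ λ x∈S → x∉r (Y-bag∩S⊆root-bag x∈S yt x∈t)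

  module BranchingRoot {c₁ c₂ : Fin (n T)} (r-c₁ : adj T root c₁ ≡ true) (r-c₂ : adj T root c₂ ≡ true)
                       (c₁≢c₂ : c₁ ≢ c₂) where
    open RootedTree T root
    open Component c₁ (adj⇒≢ T r-c₁) public

    Y : Pred (Fin (n T)) 0ℓ
    Y t = t ∉ₛ C × t ≢ root

    Y-closed : Closed Y
    Y-closed {t} {s} (t∉C , t≢r) e s≢r = (λ s∈C → t∉C (C-closed s∈C (adj-swap T e) t≢r)) , s≢r

    split : ∀ t → t ≡ root ⊎ t ∈ₛ C ⊎ Y t
    split t with t FinP.≟ root | t ∈? C
    ... | yes t≡r | _       = inj₁ t≡r
    ... | no  _   | yes t∈C = inj₂ (inj₁ t∈C)
    ... | no  t≢r | no  t∉C = inj₂ (inj₂ (t∉C , t≢r))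

    split′ : ∀ t → t ≡ root ⊎ Y t ⊎ t ∈ₛ C
    split′ t with split t
    ... | inj₁ t≡r        = inj₁ t≡r
    ... | inj₂ (inj₁ t∈C) = inj₂ (inj₂ t∈C)
    ... | inj₂ (inj₂ yt)  = inj₂ (inj₁ yt)

    module H₁ = Half (_∈ₛ C) Y (_∈? C) C-closed Y-closed split (λ t∈C yt → proj₁ yt t∈C) (λ yr → proj₂ yr refl)
    module H₂ = Half Y (_∈ₛ C) (λ t → ¬? (t ∈? C) ×-dec ¬? (t FinP.≟ root)) Y-closed C-closed split′
                     (λ yt t∈C → proj₁ yt t∈C) r∉C

    c₂∈Y : Y c₂
    c₂∈Y = (λ c₂∈C → let w , _ , w≢r = C-walk c₂∈C in neighbours-linked-only-via-root T-acyc r-c₁ r-c₂ c₁≢c₂ w w≢r) ,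
           adj⇒≢ T r-c₂

    Q₁⊎Q₂ : ∀ t → t ∈ₛ H₁.Q ⊎ t ∈ₛ H₂.Q
    Q₁⊎Q₂ t with split t
    ... | inj₁ t≡r        = inj₁ (∈-subsetOf⁺ H₁.Q? (inj₁ t≡r))
    ... | inj₂ (inj₁ t∈C) = inj₁ (∈-subsetOf⁺ H₁.Q? (inj₂ t∈C))
    ... | inj₂ (inj₂ yt)  = inj₂ (∈-subsetOf⁺ H₂.Q? (inj₂ yt))

    S₁∩S₂⊆root-bag : ∀ {v} → v ∈ₛ H₁.S → v ∈ₛ H₂.S → v ∈ₛ β root
    S₁∩S₂⊆root-bag v∈S₁ v∈S₂ with H₂.S-∈⁻ v∈S₂
    ... | t , t∈Q₂ , v∈t with ∈-subsetOf⁻ H₂.Q? t∈Q₂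
    ...   | inj₁ refl = v∈t
    ...   | inj₂ yt   = H₁.Y-bag∩S⊆root-bag v∈S₁ yt v∈t

    pushoutCover : PushoutCover {G₁ = toGr (graph H₁.F′)} {G₂ = toGr (graph H₂.F′)} {a = H₁.labS} {b = H₂.labS} F
    pushoutCover = record
      { f₁ = embed H₁.S ; f₂ = embed H₂.S ; f₁-injective = embed-injective H₁.S ; f₂-injective = embed-injective H₂.S
      ; glue = λ l → trans (H₁.embed-labS l) (sym (H₂.embed-labS l))
      ; meet = meet
      ; cover = cover
      ; edge-split = edge-split
      ; f₁-edge = id
      ; f₂-edge = id }
      where
      meet : ∀ x y → embed H₁.S x ≡ embed H₂.S y → ∃ λ l → y ≡ H₂.labS l
      meet x y eq with root-bag⁻ (S₁∩S₂⊆root-bag (embed-∈ H₁.S x) (subst (_∈ₛ H₂.S) (sym eq) (embed-∈ H₂.S y)))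
      ... | l , lab≡ = l , embed-injective H₂.S (trans (sym eq) (trans (sym lab≡) (sym (H₂.embed-labS l))))

      cover : ∀ z → (∃ λ x → embed H₁.S x ≡ z) ⊎ (∃ λ y → embed H₂.S y ≡ z)
      cover z with cover-v z
      ... | t , z∈t with Q₁⊎Q₂ t
      ...   | inj₁ t∈Q₁ = inj₁ (embed-surjective H₁.S (H₁.S-∈⁺ t t∈Q₁ z∈t))
      ...   | inj₂ t∈Q₂ = inj₂ (embed-surjective H₂.S (H₂.S-∈⁺ t t∈Q₂ z∈t))

      edge-split : ∀ z z′ → adj (graph F) z z′ ≡ true → _
      edge-split z z′ e with cover-e z z′ e
      ... | t , z∈t , z′∈t with Q₁⊎Q₂ t
      ...   | inj₁ t∈Q₁ with embed-surjective H₁.S (H₁.S-∈⁺ t t∈Q₁ z∈t) | embed-surjective H₁.S (H₁.S-∈⁺ t t∈Q₁ z′∈t)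
      ...     | x , refl | y , refl = inj₁ (x , y , refl , refl , e)
      edge-split z z′ e | t , z∈t , z′∈t | inj₂ t∈Q₂
                with embed-surjective H₂.S (H₂.S-∈⁺ t t∈Q₂ z∈t) | embed-surjective H₂.S (H₂.S-∈⁺ t t∈Q₂ z′∈t)
      ...     | x , refl | y , refl = inj₂ (x , y , refl , refl , e)

  isGluing-at-branching-root : 1 ≤ k → ∀ {c₁ c₂} → adj T root c₁ ≡ true → adj T root c₂ ≡ true → c₁ ≢ c₂ →
                               IsGluing k F
  isGluing-at-branching-root k≥1 {c₁} {c₂} r-c₁ r-c₂ c₁≢c₂
    with ∃-∈-∉-adjacent k≥1 (adj-swap T r-c₁) | ∃-∈-∉-adjacent k≥1 (adj-swap T r-c₂)
  ... | x₁ , x₁∈c₁ , x₁∉r | x₂ , x₂∈c₂ , x₂∉r =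
    H₁.F′ , H₂.F′ , H₁.F′-TW , H₂.F′-TW , H₁.fewer-vertices c₂∈Y x₂∈c₂ x₂∉r , H₂.fewer-vertices c∈C x₁∈c₁ x₁∉r ,
    PushoutCover⇒≅ H₂.labS-injective pushoutCover H₁.labS H₁.embed-labS
    where open BranchingRoot r-c₁ r-c₂ c₁≢c₂

lemma11 : (k : ℕ) → 1 ≤ k → (F : DLab k) → TW k F →
    (F ≅ 𝟏 k)
    ⊎ (Σ (List (Fin k × Fin k)) λ A → IsPairSet A × Σ (DLab k) λ F′ →
         TW k F′ × nE F′ < nE F × F ≅ (prodA k A · toL F′))
    ⊎ (Σ (Fin k) λ i → Σ (DLab k) λ F′ →
         TW k F′ × nV F′ < nV F × F ≅ (𝐉 k i · toL F′))
    ⊎ (Σ (DLab k) λ F₁ → Σ (DLab k) λ F₂ →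
         TW k F₁ × TW k F₂ × nV F₁ < nV F × nV F₂ < nV F × F ≅ (toL F₁ ⊙ toL F₂))
lemma11 k k≥1 F D with labelEdge? F
... | inj₁ (i , j , i<j , e) = inj₂ (inj₁ (splitOffLabelEdge F D i j i<j e))
... | inj₂ none with neighbours-cases (TWDecomp.T D) (TWDecomp.root D)
...   | inj₁ isolated = inj₁ (≅𝟏-if-root-isolated F D none isolated)
...   | inj₂ (inj₁ (c , r-c , leaf)) = inj₂ (inj₂ (inj₁ (splitOffVertex-at-leaf-root F D k≥1 none c r-c leaf)))
...   | inj₂ (inj₂ (_ , _ , r-c₁ , r-c₂ , c₁≢c₂)) =
        inj₂ (inj₂ (inj₂ (isGluing-at-branching-root F D k≥1 r-c₁ r-c₂ c₁≢c₂)))
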